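{- Let $P_n$ be the path with vertices $1,\dots,n$ and edges $\{i,i+1\}$ ($1\le i<n$), and let $f_0$ be a configuration on $P_n$. Let $\mathsf{AP}(P_n,f_0)$ be the output of the following algorithm: set $j=0$; while $f_j$ is not the identity, increase $j$ by one, let $S_j=\{\{i,i+1\}\mid 1\le i<n,\ f_{j-1}(i)>f_{j-1}(i+1),\ i+j\text{ even}\}$ and $f_j=f_{j-1}S_j$; output $\langle S_1,\dots,S_j\rangle$. Then for every odd-even sequence $\vec S$ of parallel swaps such that $f_0\vec S$ is the identity, $|\mathsf{AP}(P_n,f_0)|\le|\vec S|$.
   Context: A configuration on $P_n$ is a bijection $f:\{1,\dots,n\}\to\{1,\dots,n\}$. A parallel swap is a matching $S$ of $P_n$; $fS(u)=f(v)$ if $\{u,v\}\in S$ and $fS(u)=f(u)$ if $u$ is covered by no edge of $S$; sequences are applied left to right; $|\vec S|$ is the number of parallel swaps in $\vec S$. A sequence $\langle S_1,\dots,S_m\rangle$ is odd-even if for each odd $j$ every edge of $S_j$ has the form $\{2i-1,2i\}$ for some $i\ge1$, and for each even $j$ every edge of $S_j$ has the form $\{2i,2i+1\}$ for some $i\ge1$. -}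

module Defs where

open import Data.Nat using (ℕ; zero; suc; _+_)
open import Data.Fin using (Fin; zero; suc; inject₁; toℕ; _<?_)
open import Data.Fin.Properties using (all?; _≟_)
open import Data.Bool using (Bool; true; false; _∧_; if_then_else_)
open import Data.Maybe using (Maybe; just; nothing)
import Data.Maybe as Maybe
open import Data.List using (List; []; _∷_)
open import Data.Unit using (⊤)
open import Data.Product using (Σ; _×_; _,_)
open import Relation.Binary.PropositionalEquality using (_≡_)
open import Relation.Nullary using (Dec; yes; no; does)

-- Vertices of P_n are Fin n; the 0-based vertex u stands for vertex u+1 of P_n.
-- A configuration on P_n: a function Fin n → Fin n (bijectivity is a hypothesis).
Config : ℕ → Set
Config n = Fin n → Fin n

next : ∀ {n} → Fin n → Maybe (Fin n)
next {suc zero} zero = nothing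
next {suc (suc n)} zero = just (suc zero)
next {suc n} (suc i) = Maybe.map suc (next i)

prev : ∀ {n} → Fin n → Maybe (Fin n)
prev zero = nothing
prev (suc i) = just (inject₁ i)

-- A set of edges of P_n: S u ≡ true means the edge {u, u+1} (0-based) is in S.
Edges : ℕ → Set
Edges n = Fin n → Bool

-- S is a matching of P_n: every selected u has a successor v (so {u,v} is an
-- edge of P_n) and the edge {v, v+1} is not selected (edges are pairwise disjoint).
IsMatching : ∀ {n} → Edges n → Set
IsMatching {n} S = ∀ (u : Fin n) → S u ≡ true →
  Σ (Fin n) λ v → (next u ≡ just v) × (S v ≡ false)

-- f S : (fS)(u) = f(v) if {u,v} ∈ S, f(u) otherwise.
applyLeft : ∀ {n} → Config n → Edges n → Fin n → Fin n
applyLeft f S u with prev u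
... | nothing = f u
... | just w = if S w then f w else f u

apply : ∀ {n} → Config n → Edges n → Config n
apply f S u with S u | next u
... | true | just v = f v
... | _ | _ = applyLeft f S u

applySeq : ∀ {n} → Config n → List (Edges n) → Config n
applySeq f [] = f
applySeq f (S ∷ Ss) = applySeq (apply f S) Ss

isEven : ℕ → Bool
isEven zero = true
isEven (suc zero) = false
isEven (suc (suc m)) = isEven m

-- Odd-even: the j-th swap (1-based j) uses only edges {i,i+1} (1-based i = toℕ u + 1)
-- with i odd when j is odd, and i even when j is even, i.e. i + j even.
OddEvenFrom : ∀ {n} → ℕ → List (Edges n) → Set
OddEvenFrom j [] = ⊤
OddEvenFrom {n} j (S ∷ Ss) =
  (∀ (u : Fin n) → S u ≡ true → isEven (suc (toℕ u) + j) ≡ true)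
  × OddEvenFrom (suc j) Ss

OddEven : ∀ {n} → List (Edges n) → Set
OddEven Ss = OddEvenFrom 1 Ss

-- The swap set S_j of the algorithm AP, computed from f = f_{j-1}:
-- {i,i+1} with f(i) > f(i+1) and i + j even (1-based i).
apSet : ∀ {n} → ℕ → Config n → Edges n
apSet j f u with next u
... | nothing = false
... | just v = does (f v <? f u) ∧ isEven (suc (toℕ u) + j)

isIdentity? : ∀ {n} (f : Config n) → Dec (∀ u → f u ≡ u)
isIdentity? f = all? (λ u → f u ≟ u)

-- The algorithm AP run with a fuel bound; the counter j is the number of
-- swaps done so far.  Returns nothing if the fuel runs out before f_j is the identity.
runAP : ∀ {n} → ℕ → ℕ → Config n → Maybe (List (Edges n))
runAP fuel j f with isIdentity? f
... | yes _ = just []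
runAP zero j f | no _ = nothing
runAP (suc k) j f | no _ =
  Maybe.map (apSet (suc j) f ∷_) (runAP k (suc j) (apply f (apSet (suc j) f)))

-- The 0-1 principle. For a threshold t, count the positions at or after k that hold
-- a value ≥ t; say f dominates g when each such count for g is at most the one for f,
-- with equality for k = 0. A swap step using edges of one parity changes these counts
-- only at cuts k that split a swapped edge {k-1, k}, and there the compare-exchange of
-- AP puts the larger value on the right, which is the most any swap of that edge can
-- achieve. Run beside an arbitrary odd-even sequence from the same f₀, AP therefore
-- keeps dominating it; and only the identity dominates the identity, so AP has stopped
-- by the time the other sequence has sorted.
module Submission where

open import Defs
open import Data.Nat using (ℕ; zero; suc; _+_; _∸_; _≤_; _<_; z≤n; s≤s; s≤s⁻¹; z<s; _≤?_)
  renaming (_<?_ to _<ℕ?_)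
open import Data.Nat.Properties hiding (_<?_)
open import Algebra.Properties.CommutativeSemigroup +-commutativeSemigroup using (x∙yz≈y∙xz)
open import Data.Fin using (Fin; zero; suc; toℕ; fromℕ<; inject₁; _<?_)
open import Data.Fin.Properties using (toℕ-injective; toℕ<n; toℕ-fromℕ<; toℕ-inject₁)
open import Data.Bool using (Bool; true; false; _∧_)
open import Data.Bool.Properties using (∧-conicalʳ)
open import Data.Maybe using (Maybe; just; nothing; maybe′)
import Data.Maybe as Maybe
open import Data.List using (List; []; _∷_; length)
open import Data.List.Relation.Unary.All using (All; []; _∷_)
open import Data.Product using (Σ; ∃; _×_; _,_; proj₁; proj₂)
open import Data.Sum using (_⊎_; inj₁; inj₂)
open import Data.Empty using (⊥-elim)
open import Function using (_∘_; case_of_)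
open import Relation.Binary.PropositionalEquality
open import Relation.Nullary using (¬_; yes; no; does)
open import Relation.Nullary.Decidable using (dec-true; dec-false)
open import Function.Definitions using (Bijective)

fromℕ? : ∀ n → ℕ → Maybe (Fin n)
fromℕ? zero    _       = nothing
fromℕ? (suc n) zero    = just zero
fromℕ? (suc n) (suc i) = Maybe.map suc (fromℕ? n i)

fromℕ?-toℕ : ∀ {n} (u : Fin n) → fromℕ? n (toℕ u) ≡ just u
fromℕ?-toℕ zero    = refl
fromℕ?-toℕ (suc u) rewrite fromℕ?-toℕ u = refl

toℕ-fromℕ? : ∀ n i {u : Fin n} → fromℕ? n i ≡ just u → toℕ u ≡ i
toℕ-fromℕ? (suc n) zero    refl = refl
toℕ-fromℕ? (suc n) (suc i) eq with fromℕ? n i in e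
toℕ-fromℕ? (suc n) (suc i) refl | just u = cong suc (toℕ-fromℕ? n i e)

position : ∀ {n i} → i < n → ∃ λ (u : Fin n) → toℕ u ≡ i
position i<n = fromℕ< i<n , toℕ-fromℕ< i<n

toℕ-next : ∀ {n} {u v : Fin n} → next u ≡ just v → toℕ v ≡ suc (toℕ u)
toℕ-next {suc (suc n)} {zero} refl = refl
toℕ-next {suc (suc n)} {suc u} eq with next u in e
toℕ-next {suc (suc n)} {suc u} refl | just v = cong suc (toℕ-next e)

next-< : ∀ {n} (u : Fin n) → suc (toℕ u) < n → ∃ λ v → next u ≡ just v
next-< {suc zero}    zero    (s≤s ())
next-< {suc (suc n)} zero    _       = suc zero , refl
next-< {suc (suc n)} (suc u) (s≤s p) with next-< u p
... | v , e = suc v , cong (Maybe.map suc) e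

toℕ-prev : ∀ {n} {u w : Fin n} → prev u ≡ just w → toℕ u ≡ suc (toℕ w)
toℕ-prev {u = suc u} refl = cong suc (sym (toℕ-inject₁ u))

prev-next : ∀ {n} {u v : Fin n} → next u ≡ just v → prev v ≡ just u
prev-next {v = zero}  nu with () ← toℕ-next nu
prev-next {v = suc v} nu =
  cong just (toℕ-injective (trans (toℕ-inject₁ v) (suc-injective (toℕ-next nu))))

module _ {n} (f : Config n) (S : Edges n) where

  apply-matchedˡ : ∀ {u v} → S u ≡ true → next u ≡ just v → apply f S u ≡ f v
  apply-matchedˡ Su nu rewrite Su | nu = refl

  apply-matchedʳ : ∀ {u v} → S u ≡ true → next u ≡ just v → S v ≡ false → apply f S v ≡ f u
  apply-matchedʳ Su nu Sv rewrite Sv | prev-next nu | Su = refl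

  apply-unmatched : ∀ {u} → S u ≡ false → (∀ w → prev u ≡ just w → S w ≡ false) → apply f S u ≡ f u
  apply-unmatched {u} Su free rewrite Su with prev u
  ... | nothing = refl
  ... | just w rewrite free w refl = refl

  apply-unmatchedʳ : ∀ {u v} → S u ≡ false → next u ≡ just v → S v ≡ false → apply f S v ≡ f v
  apply-unmatchedʳ Su nu Sv = apply-unmatched Sv λ w pv → case trans (sym (prev-next nu)) pv of λ where
    refl → Su

-- ℕ-indexed views, so that counting over suffixes needs no Fin bounds;
-- positions ≥ n read as value 0 and as unselected.
valueAt : ∀ {n} → Config n → ℕ → ℕ
valueAt {n} f i = maybe′ (toℕ ∘ f) 0 (fromℕ? n i)

valueAt-toℕ : ∀ {n} (f : Config n) (u : Fin n) → valueAt f (toℕ u) ≡ toℕ (f u)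
valueAt-toℕ f u rewrite fromℕ?-toℕ u = refl

selected : ∀ {n} → Edges n → ℕ → Bool
selected {n} S i = maybe′ S false (fromℕ? n i)

selected-toℕ : ∀ {n} (S : Edges n) (u : Fin n) → selected S (toℕ u) ≡ S u
selected-toℕ S u rewrite fromℕ?-toℕ u = refl

selected⇒position : ∀ {n} (S : Edges n) i → selected S i ≡ true →
  ∃ λ u → toℕ u ≡ i × S u ≡ true
selected⇒position {n} S i h with fromℕ? n i in e
... | just u  = u , toℕ-fromℕ? n i e , h
... | nothing with () ← h

_⊆ᵇ_ : (ℕ → Bool) → (ℕ → Bool) → Set
e ⊆ᵇ E = ∀ i → e i ≡ true → E i ≡ true

⊆ᵇ-false : ∀ {e E : ℕ → Bool} → e ⊆ᵇ E → ∀ {i} → E i ≡ false → e i ≡ false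
⊆ᵇ-false {e} e⊆E {i} Ei with e i in ei
... | false = refl
... | true  = trans (sym (e⊆E i ei)) Ei

selected-⊆ᵇ : ∀ {n} {S : Edges n} {E : ℕ → Bool} →
  (∀ u → S u ≡ true → E (toℕ u) ≡ true) → selected S ⊆ᵇ E
selected-⊆ᵇ {S = S} S⊆E i h with selected⇒position S i h
... | u , refl , Su = S⊆E u Su

NotRightEnd : (ℕ → Bool) → ℕ → Set
NotRightEnd e k = ∀ j → k ≡ suc j → e j ≡ false

notRightEnd-zero : ∀ {e} → NotRightEnd e 0
notRightEnd-zero _ ()

notRightEnd-suc : ∀ {e : ℕ → Bool} {j} → e j ≡ false → NotRightEnd e (suc j)
notRightEnd-suc ej _ refl = ej

record IsSwapStep (n : ℕ) (V V' : ℕ → ℕ) (e : ℕ → Bool) : Set where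
  field
    inRange  : ∀ i → e i ≡ true → suc i < n
    disjoint : ∀ i → e i ≡ true → e (suc i) ≡ false
    swapˡ    : ∀ i → e i ≡ true → V' i ≡ V (suc i)
    swapʳ    : ∀ i → e i ≡ true → V' (suc i) ≡ V i
    fixed    : ∀ i → i < n → e i ≡ false → NotRightEnd e i → V' i ≡ V i

apply-isSwapStep : ∀ {n} (f : Config n) (S : Edges n) → IsMatching S →
  IsSwapStep n (valueAt f) (valueAt (apply f S)) (selected S)
apply-isSwapStep {n} f S matching = record
  { inRange = inRange ; disjoint = disjoint ; swapˡ = swapˡ ; swapʳ = swapʳ ; fixed = fixed }
  where
  f' : Config n
  f' = apply f S

  edge : ∀ i → selected S i ≡ true → Σ (Fin n) λ u → Σ (Fin n) λ v →
         toℕ u ≡ i × S u ≡ true × next u ≡ just v × S v ≡ false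
  edge i h with selected⇒position S i h
  ... | u , tu , Su with matching u Su
  ...   | v , nu , Sv = u , v , tu , Su , nu , Sv

  inRange : ∀ i → selected S i ≡ true → suc i < n
  inRange i h with edge i h
  ... | u , v , refl , _ , nu , _ rewrite sym (toℕ-next nu) = toℕ<n v

  disjoint : ∀ i → selected S i ≡ true → selected S (suc i) ≡ false
  disjoint i h with edge i h
  ... | u , v , refl , _ , nu , Sv rewrite sym (toℕ-next nu) = trans (selected-toℕ S v) Sv

  swapˡ : ∀ i → selected S i ≡ true → valueAt f' i ≡ valueAt f (suc i)
  swapˡ i h with edge i h
  ... | u , v , refl , Su , nu , _
    rewrite sym (toℕ-next nu) | valueAt-toℕ f' u | valueAt-toℕ f v =
    cong toℕ (apply-matchedˡ f S Su nu)

  swapʳ : ∀ i → selected S i ≡ true → valueAt f' (suc i) ≡ valueAt f i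
  swapʳ i h with edge i h
  ... | u , v , refl , Su , nu , Sv
    rewrite sym (toℕ-next nu) | valueAt-toℕ f' v | valueAt-toℕ f u =
    cong toℕ (apply-matchedʳ f S Su nu Sv)

  fixed : ∀ i → i < n → selected S i ≡ false → NotRightEnd (selected S) i →
          valueAt f' i ≡ valueAt f i
  fixed i i<n h notEnd with position i<n
  ... | u , refl rewrite valueAt-toℕ f' u | valueAt-toℕ f u =
    cong toℕ (apply-unmatched f S (trans (sym (selected-toℕ S u)) h) free)
    where
    free : ∀ w → prev u ≡ just w → S w ≡ false
    free w pw = trans (sym (selected-toℕ S w)) (notEnd (toℕ w) (toℕ-prev pw))

high : ℕ → ℕ → ℕ
high t x with t ≤? x
... | yes _ = 1
... | no  _ = 0

high≤1 : ∀ t x → high t x ≤ 1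
high≤1 t x with t ≤? x
... | yes _ = ≤-refl
... | no  _ = z≤n

high-mono : ∀ t {x y} → x ≤ y → high t x ≤ high t y
high-mono t {x} {y} x≤y with t ≤? x | t ≤? y
... | yes _   | yes _ = ≤-refl
... | yes t≤x | no t≰y = ⊥-elim (t≰y (≤-trans t≤x x≤y))
... | no  _   | _     = z≤n

high-≤ : ∀ {t x} → t ≤ x → high t x ≡ 1
high-≤ {t} {x} t≤x with t ≤? x
... | yes _   = refl
... | no t≰x = ⊥-elim (t≰x t≤x)

high-> : ∀ {t x} → x < t → high t x ≡ 0
high-> {t} {x} x<t with t ≤? x
... | yes t≤x = ⊥-elim (<-irrefl refl (<-≤-trans x<t t≤x))
... | no  _   = refl

high-pos⇒≤ : ∀ {t x} → 0 < high t x → t ≤ x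
high-pos⇒≤ {t} {x} p with t ≤? x
... | yes t≤x = t≤x
... | no  _   = ⊥-elim (<-irrefl refl p)

high-zero⇒> : ∀ {t x} → high t x ≡ 0 → x < t
high-zero⇒> {t} {x} p with t ≤? x
... | yes _  with () ← p
... | no t≰x = ≰⇒> t≰x

sumFrom : (ℕ → ℕ) → ℕ → ℕ → ℕ
sumFrom b k zero    = 0
sumFrom b k (suc m) = b k + sumFrom b (suc k) m

sumFrom-≤ : ∀ {b} → (∀ j → b j ≤ 1) → ∀ k m → sumFrom b k m ≤ m
sumFrom-≤ b≤1 k zero    = z≤n
sumFrom-≤ b≤1 k (suc m) = +-mono-≤ (b≤1 k) (sumFrom-≤ b≤1 (suc k) m)

sumFrom-ones : ∀ b k m → (∀ j → k ≤ j → j < k + m → b j ≡ 1) → sumFrom b k m ≡ m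
sumFrom-ones b k zero    ones = refl
sumFrom-ones b k (suc m) ones =
  cong₂ _+_ (ones k ≤-refl (m<m+n k z<s))
            (sumFrom-ones b (suc k) m λ j k<j j< →
               ones j (<⇒≤ k<j) (subst (j <_) (sym (+-suc k m)) j<))

sumFrom-zeros : ∀ b k m → (∀ j → j < k + m → b j ≡ 0) → sumFrom b k m ≡ 0
sumFrom-zeros b k zero    zeros = refl
sumFrom-zeros b k (suc m) zeros =
  cong₂ _+_ (zeros k (m<m+n k z<s))
            (sumFrom-zeros b (suc k) m λ j j< → zeros j (subst (j <_) (sym (+-suc k m)) j<))

sumFrom-++ : ∀ b k l m → sumFrom b k (l + m) ≡ sumFrom b k l + sumFrom b (k + l) m
sumFrom-++ b k zero    m rewrite +-identityʳ k = refl
sumFrom-++ b k (suc l) m rewrite sumFrom-++ b (suc k) l m | +-suc k l =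
  sym (+-assoc (b k) (sumFrom b (suc k) l) _)

sumFrom-last : ∀ b k m → b (k + m) ≤ sumFrom b k (suc m)
sumFrom-last b k zero    rewrite +-identityʳ k = m≤m+n (b k) 0
sumFrom-last b k (suc m) rewrite +-suc k m =
  ≤-trans (sumFrom-last b (suc k) m) (m≤n+m _ (b k))

highCount : ℕ → ℕ → (ℕ → ℕ) → ℕ → ℕ
highCount n t V k = sumFrom (high t ∘ V) k (n ∸ k)

highCount-step : ∀ n t V {k} → k < n → highCount n t V k ≡ high t (V k) + highCount n t V (suc k)
highCount-step n t V {k} k<n rewrite +-∸-assoc 1 k<n = refl

highCount-beyond : ∀ n t V {k} → n ≤ k → highCount n t V k ≡ 0
highCount-beyond n t V n≤k rewrite m≤n⇒m∸n≡0 n≤k = refl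

highCount-prefix : ∀ n t V {k} → k ≤ n →
  highCount n t V 0 ≡ sumFrom (high t ∘ V) 0 k + highCount n t V k
highCount-prefix n t V {k} k≤n =
  trans (cong (sumFrom (high t ∘ V) 0) (sym (m+[n∸m]≡n k≤n)))
        (sumFrom-++ (high t ∘ V) 0 k (n ∸ k))

highCount-≤ : ∀ n t V k → highCount n t V k ≤ n ∸ k
highCount-≤ n t V k = sumFrom-≤ (λ j → high≤1 t (V j)) k (n ∸ k)

module _ {n} {V V' : ℕ → ℕ} {e : ℕ → Bool} (swap : IsSwapStep n V V' e) (t : ℕ) where
  open IsSwapStep swap

  sumFrom-swap : ∀ m k → k + m ≡ n → NotRightEnd e k →
    sumFrom (high t ∘ V') k m ≡ sumFrom (high t ∘ V) k m
  sumFrom-swap zero    k _      _      = refl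
  sumFrom-swap (suc m) k k+m≡n notEnd with e k in ek
  ... | false =
    cong₂ _+_ (cong (high t) (fixed k (subst (k <_) k+m≡n (m<m+n k z<s)) ek notEnd))
              (sumFrom-swap m (suc k) (trans (sym (+-suc k m)) k+m≡n) (notRightEnd-suc ek))
  ... | true with m
  ...   | zero = ⊥-elim (<-irrefl (trans (sym (+-comm k 1)) k+m≡n) (inRange k ek))
  ...   | suc m' = begin
      high t (V' k) + (high t (V' (suc k)) + rest V')
        ≡⟨ cong₂ (λ x y → high t x + (high t y + rest V')) (swapˡ k ek) (swapʳ k ek) ⟩
      high t (V (suc k)) + (high t (V k) + rest V')
        ≡⟨ cong (λ r → high t (V (suc k)) + (high t (V k) + r)) rest-swap ⟩
      high t (V (suc k)) + (high t (V k) + rest V)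
        ≡⟨ x∙yz≈y∙xz (high t (V (suc k))) (high t (V k)) (rest V) ⟩
      high t (V k) + (high t (V (suc k)) + rest V) ∎
    where
    open ≡-Reasoning
    rest : (ℕ → ℕ) → ℕ
    rest W = sumFrom (high t ∘ W) (suc (suc k)) m'
    rest-swap : rest V' ≡ rest V
    rest-swap = sumFrom-swap m' (suc (suc k))
      (trans (sym (trans (+-suc k (suc m')) (cong suc (+-suc k m')))) k+m≡n)
      (notRightEnd-suc (disjoint k ek))

  -- A swap step never moves a value across a cut that no swapped edge straddles.
  highCount-swap : ∀ k → NotRightEnd e k → highCount n t V' k ≡ highCount n t V k
  highCount-swap k notEnd with k ≤? n
  ... | yes k≤n = sumFrom-swap (n ∸ k) k (m+[n∸m]≡n k≤n) notEnd
  ... | no  k≰n = trans (highCount-beyond n t V' (<⇒≤ (≰⇒> k≰n)))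
                        (sym (highCount-beyond n t V (<⇒≤ (≰⇒> k≰n))))

swapStep-rightEnd : ∀ {n V V' d E} → IsSwapStep n V V' d → d ⊆ᵇ E →
  (∀ i → E i ≡ true → E (suc i) ≡ false) →
  ∀ {i} → E i ≡ true → suc i < n → V' (suc i) ≡ V i ⊎ V' (suc i) ≡ V (suc i)
swapStep-rightEnd {d = d} swap d⊆E E-sparse {i} Ei i+1<n with d i in di
... | true  = inj₁ (IsSwapStep.swapʳ swap i di)
... | false = inj₂ (IsSwapStep.fixed swap (suc i) i+1<n
                      (⊆ᵇ-false d⊆E (E-sparse i Ei)) (notRightEnd-suc di))

record Dominates (n : ℕ) (V W : ℕ → ℕ) : Set where
  field
    suffix : ∀ t k → highCount n t W k ≤ highCount n t V k
    total  : ∀ t → highCount n t V 0 ≡ highCount n t W 0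

dominates-refl : ∀ {n V} → Dominates n V V
dominates-refl = record { suffix = λ _ _ → ≤-refl ; total = λ _ → refl }

-- In the two positions of an edge, c is the indicator at the right end after a
-- compare-exchange (so c ≥ a, b), and y the one after an arbitrary swap (so y ∈ {x₁, x₂}).
exchange-bound : ∀ {a b c x₁ x₂ y X Y} → a ≤ c → b ≤ c → c ≤ 1 → y ≤ 1 →
  y ≤ x₁ + x₂ → Y ≤ X → x₁ + (x₂ + Y) ≤ a + (b + X) → y + Y ≤ c + X
exchange-bound {c = suc zero}    _ _ _ y≤1 _ Y≤X _ = +-mono-≤ y≤1 Y≤X
exchange-bound {c = suc (suc _)} _ _ (s≤s ()) _ _ _ _
exchange-bound {c = zero} {x₁ = x₁} {x₂ = x₂} {Y = Y} z≤n z≤n _ _ y≤x₁+x₂ _ window =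
  ≤-trans (+-monoˡ-≤ Y y≤x₁+x₂) (≤-trans (≤-reflexive (+-assoc x₁ x₂ Y)) window)

module _ {n} {E : ℕ → Bool} {V V' W W' : ℕ → ℕ} {e d : ℕ → Bool}
  (E-sparse : ∀ i → E i ≡ true → E (suc i) ≡ false)
  (V→V' : IsSwapStep n V V' e) (e⊆E : e ⊆ᵇ E)
  (exchange : ∀ i → E i ≡ true → suc i < n → V i ≤ V' (suc i) × V (suc i) ≤ V' (suc i))
  (W→W' : IsSwapStep n W W' d) (d⊆E : d ⊆ᵇ E)
  (V≽W : Dominates n V W) where

  open Dominates V≽W
  open ≤-Reasoning

  private
    across-cut : ∀ t k → NotRightEnd e k → NotRightEnd d k → highCount n t W' k ≤ highCount n t V' k
    across-cut t k e-cut d-cut = begin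
      highCount n t W' k ≡⟨ highCount-swap W→W' t k d-cut ⟩
      highCount n t W k  ≤⟨ suffix t k ⟩
      highCount n t V k  ≡⟨ highCount-swap V→V' t k e-cut ⟨
      highCount n t V' k ∎

    inside-edge : ∀ t i → E i ≡ true → suc i < n → highCount n t W' (suc i) ≤ highCount n t V' (suc i)
    inside-edge t i Ei i+1<n = begin
      highCount n t W' (suc i)                       ≡⟨ split W' W→W' (⊆ᵇ-false d⊆E E-i+1) ⟩
      high t (W' (suc i)) + highCount n t W i+2   ≤⟨ bound ⟩
      high t (V' (suc i)) + highCount n t V i+2   ≡⟨ split V' V→V' (⊆ᵇ-false e⊆E E-i+1) ⟨
      highCount n t V' (suc i)                       ∎
      where
      i+2 : ℕ
      i+2 = suc (suc i)
      E-i+1 : E (suc i) ≡ false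
      E-i+1 = E-sparse i Ei
      split : ∀ {U} U' {s} → IsSwapStep n U U' s → s (suc i) ≡ false →
              highCount n t U' (suc i) ≡ high t (U' (suc i)) + highCount n t U i+2
      split U' swap s-i+1 = trans (highCount-step n t U' i+1<n)
        (cong (high t (U' (suc i)) +_) (highCount-swap swap t i+2 (notRightEnd-suc s-i+1)))
      two-steps : ∀ U → highCount n t U i ≡ high t (U i) + (high t (U (suc i)) + highCount n t U i+2)
      two-steps U = trans (highCount-step n t U (<⇒≤ i+1<n))
                          (cong (high t (U i) +_) (highCount-step n t U i+1<n))
      window : high t (W i) + (high t (W (suc i)) + highCount n t W i+2)
             ≤ high t (V i) + (high t (V (suc i)) + highCount n t V i+2)
      window = subst₂ _≤_ (two-steps W) (two-steps V) (suffix t i)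
      W'-right : high t (W' (suc i)) ≤ high t (W i) + high t (W (suc i))
      W'-right with swapStep-rightEnd W→W' d⊆E E-sparse Ei i+1<n
      ... | inj₁ eq = subst (_≤ _) (cong (high t) (sym eq)) (m≤m+n _ _)
      ... | inj₂ eq = subst (_≤ _) (cong (high t) (sym eq)) (m≤n+m _ _)
      bound : high t (W' (suc i)) + highCount n t W i+2 ≤ high t (V' (suc i)) + highCount n t V i+2
      bound = exchange-bound {x₁ = high t (W i)} {x₂ = high t (W (suc i))}
        (high-mono t (proj₁ (exchange i Ei i+1<n))) (high-mono t (proj₂ (exchange i Ei i+1<n)))
        (high≤1 t _) (high≤1 t _) W'-right (suffix t i+2) window

  dominates-swapStep : Dominates n V' W'
  Dominates.suffix dominates-swapStep t zero = across-cut t 0 notRightEnd-zero notRightEnd-zero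
  Dominates.suffix dominates-swapStep t (suc i) with E i in Ei
  ... | false =
    across-cut t (suc i) (notRightEnd-suc (⊆ᵇ-false e⊆E Ei)) (notRightEnd-suc (⊆ᵇ-false d⊆E Ei))
  ... | true with suc i <ℕ? n
  ...   | yes i+1<n = inside-edge t i Ei i+1<n
  ...   | no  i+1≮n = ≤-reflexive (trans (highCount-beyond n t W' (≮⇒≥ i+1≮n))
                                         (sym (highCount-beyond n t V' (≮⇒≥ i+1≮n))))
  Dominates.total dominates-swapStep t = begin-equality
    highCount n t V' 0 ≡⟨ highCount-swap V→V' t 0 notRightEnd-zero ⟩
    highCount n t V 0  ≡⟨ total t ⟩
    highCount n t W 0  ≡⟨ highCount-swap W→W' t 0 notRightEnd-zero ⟨
    highCount n t W' 0 ∎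

dominates-identity : ∀ {n V W} → Dominates n V W → (∀ i → i < n → W i ≡ i) → ∀ i → i < n → V i ≡ i
dominates-identity {n} {V} {W} V≽W W-id i i<n = ≤-antisym V-i≤i i≤V-i
  where
  open Dominates V≽W
  open ≤-Reasoning

  W-count : ∀ t k → t ≤ k → k ≤ n → highCount n t W k ≡ n ∸ k
  W-count t k t≤k k≤n = sumFrom-ones (high t ∘ W) k (n ∸ k) λ j k≤j j< →
    let j<n = subst (j <_) (m+[n∸m]≡n k≤n) j< in
    high-≤ (subst (t ≤_) (sym (W-id j j<n)) (≤-trans t≤k k≤j))

  i≤V-i : i ≤ V i
  i≤V-i = high-pos⇒≤ (+-cancelʳ-≤ (n ∸ suc i) 1 (high i (V i)) (begin
    suc (n ∸ suc i)                        ≡⟨ +-∸-assoc 1 i<n ⟨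
    n ∸ i                                  ≡⟨ W-count i i ≤-refl (<⇒≤ i<n) ⟨
    highCount n i W i                      ≤⟨ suffix i i ⟩
    highCount n i V i                      ≡⟨ highCount-step n i V i<n ⟩
    high i (V i) + highCount n i V (suc i) ≤⟨ +-monoʳ-≤ (high i (V i)) (highCount-≤ n i V (suc i)) ⟩
    high i (V i) + (n ∸ suc i)             ∎))

  -- With threshold i+1 the identity has no high value before position i+1,
  -- so neither may V, since the total counts agree.
  prefix : ∀ U → ℕ
  prefix U = sumFrom (high (suc i) ∘ U) 0 (suc i)

  V-prefix : prefix V ≡ 0
  V-prefix = n≤0⇒n≡0 (+-cancelʳ-≤ (highCount n (suc i) V (suc i)) (prefix V) 0 (begin
    prefix V + highCount n (suc i) V (suc i) ≡⟨ highCount-prefix n (suc i) V i<n ⟨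
    highCount n (suc i) V 0                  ≡⟨ total (suc i) ⟩
    highCount n (suc i) W 0                  ≡⟨ highCount-prefix n (suc i) W i<n ⟩
    prefix W + highCount n (suc i) W (suc i) ≡⟨ cong (_+ highCount n (suc i) W (suc i)) W-prefix ⟩
    highCount n (suc i) W (suc i)            ≤⟨ suffix (suc i) (suc i) ⟩
    highCount n (suc i) V (suc i)            ∎))
    where
    W-prefix : prefix W ≡ 0
    W-prefix = sumFrom-zeros _ 0 (suc i) λ j j≤i →
      high-> (subst (_< suc i) (sym (W-id j (<-≤-trans j≤i i<n))) j≤i)

  V-i≤i : V i ≤ i
  V-i≤i = s≤s⁻¹ (high-zero⇒> (n≤0⇒n≡0 (begin
    high (suc i) (V i) ≤⟨ sumFrom-last (high (suc i) ∘ V) 0 i ⟩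
    prefix V           ≡⟨ V-prefix ⟩
    0                  ∎)))

-- The paper's condition “i + j even” for the 1-based edge {i, i+1}, with 0-based i.
stepEdges : ℕ → ℕ → Bool
stepEdges j i = isEven (suc i + j)

isEven-suc : ∀ m → isEven m ≡ true → isEven (suc m) ≡ false
isEven-suc zero          _ = refl
isEven-suc (suc (suc m)) h = isEven-suc m h

stepEdges-sparse : ∀ j i → stepEdges j i ≡ true → stepEdges j (suc i) ≡ false
stepEdges-sparse j i = isEven-suc (suc i + j)

module _ {n} (j : ℕ) (f : Config n) where

  apSet-next : ∀ {u v} → next u ≡ just v → apSet j f u ≡ (does (f v <? f u) ∧ stepEdges j (toℕ u))
  apSet-next nu rewrite nu = refl

  apSet-parity : ∀ u → apSet j f u ≡ true → stepEdges j (toℕ u) ≡ true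
  apSet-parity u h with next u
  ... | just v = ∧-conicalʳ _ _ h

  apSet-sparse : ∀ {u v} → next u ≡ just v → stepEdges j (toℕ u) ≡ true → apSet j f v ≡ false
  apSet-sparse {u} {v} nu par with apSet j f v in Sv
  ... | false = refl
  ... | true  = trans (sym (apSet-parity v Sv))
                      (trans (cong (stepEdges j) (toℕ-next nu)) (stepEdges-sparse j (toℕ u) par))

  apSet-isMatching : IsMatching (apSet j f)
  apSet-isMatching u h with next u in nu
  ... | just v = v , refl , apSet-sparse nu (∧-conicalʳ _ _ h)

  apSet-descent : ∀ {u v} → next u ≡ just v → stepEdges j (toℕ u) ≡ true →
    toℕ (f v) < toℕ (f u) → apSet j f u ≡ true
  apSet-descent {u} {v} nu par fv<fu =
    trans (apSet-next nu) (cong₂ _∧_ (dec-true (f v <? f u) fv<fu) par)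

  apSet-ascent : ∀ {u v} → next u ≡ just v → ¬ toℕ (f v) < toℕ (f u) → apSet j f u ≡ false
  apSet-ascent {u} {v} nu fv≮fu =
    trans (apSet-next nu) (cong (_∧ stepEdges j (toℕ u)) (dec-false (f v <? f u) fv≮fu))

  apply-apSet-max : ∀ {u v} → next u ≡ just v → stepEdges j (toℕ u) ≡ true →
    toℕ (f u) ≤ toℕ (apply f (apSet j f) v) × toℕ (f v) ≤ toℕ (apply f (apSet j f) v)
  apply-apSet-max {u} {v} nu par with f v <? f u
  ... | yes fv<fu
    rewrite apply-matchedʳ f (apSet j f) (apSet-descent nu par fv<fu) nu (apSet-sparse nu par) =
    ≤-refl , <⇒≤ fv<fu
  ... | no fv≮fu
    rewrite apply-unmatchedʳ f (apSet j f) (apSet-ascent nu fv≮fu) nu (apSet-sparse nu par) =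
    ≮⇒≥ fv≮fu , ≤-refl

  apply-apSet-exchange : ∀ i → stepEdges j i ≡ true → suc i < n →
    valueAt f i ≤ valueAt (apply f (apSet j f)) (suc i) ×
    valueAt f (suc i) ≤ valueAt (apply f (apSet j f)) (suc i)
  apply-apSet-exchange i par i+1<n with position (<⇒≤ i+1<n)
  ... | u , refl with next-< u i+1<n
  ...   | v , nu rewrite sym (toℕ-next nu) | valueAt-toℕ f u | valueAt-toℕ f v
                       | valueAt-toℕ (apply f (apSet j f)) v = apply-apSet-max nu par

ConfigDominates : ∀ {n} → Config n → Config n → Set
ConfigDominates {n} f g = Dominates n (valueAt f) (valueAt g)

dominates-apStep : ∀ {n} j (f g : Config n) (S : Edges n) → IsMatching S →
  (∀ u → S u ≡ true → stepEdges j (toℕ u) ≡ true) →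
  ConfigDominates f g → ConfigDominates (apply f (apSet j f)) (apply g S)
dominates-apStep j f g S matching parity =
  dominates-swapStep (stepEdges-sparse j)
    (apply-isSwapStep f (apSet j f) (apSet-isMatching j f)) (selected-⊆ᵇ (apSet-parity j f))
    (apply-apSet-exchange j f)
    (apply-isSwapStep g S matching) (selected-⊆ᵇ parity)

dominates-sorted : ∀ {n} {f g : Config n} → ConfigDominates f g → (∀ u → g u ≡ u) → ∀ u → f u ≡ u
dominates-sorted {n} {f} {g} f≽g g-sorted u = toℕ-injective (begin
  toℕ (f u)        ≡⟨ valueAt-toℕ f u ⟨
  valueAt f (toℕ u) ≡⟨ dominates-identity f≽g g-id (toℕ u) (toℕ<n u) ⟩
  toℕ u            ∎)
  where
  open ≡-Reasoning
  g-id : ∀ i → i < n → valueAt g i ≡ i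
  g-id i i<n with position i<n
  ... | w , refl = trans (valueAt-toℕ g w) (cong toℕ (g-sorted w))

runAP-within : ∀ {n} j (f g : Config n) (Ss : List (Edges n)) → All IsMatching Ss →
  OddEvenFrom (suc j) Ss → ConfigDominates f g → (∀ u → applySeq g Ss u ≡ u) →
  Σ (List (Edges n)) λ out → runAP (length Ss) j f ≡ just out × length out ≤ length Ss
runAP-within j f g Ss ms oe f≽g sorted with isIdentity? f
... | yes _ = [] , refl , z≤n
runAP-within j f g [] ms oe f≽g sorted | no unsorted = ⊥-elim (unsorted (dominates-sorted f≽g sorted))
runAP-within j f g (S ∷ Ss) (m ∷ ms) (parity , oe) f≽g sorted | no _
  with runAP-within (suc j) _ _ Ss ms oe (dominates-apStep (suc j) f g S m parity f≽g) sorted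
... | out , run , out≤Ss rewrite run = apSet (suc j) f ∷ out , refl , s≤s out≤Ss

corollary1 : ∀ {n} (f₀ : Config n) → Bijective _≡_ _≡_ f₀ →
    (Ss : List (Edges n)) → All IsMatching Ss → OddEven Ss →
    (∀ u → applySeq f₀ Ss u ≡ u) →
    Σ ℕ λ fuel → Σ (List (Edges n)) λ out →
      (runAP fuel 0 f₀ ≡ just out) × (length out ≤ length Ss)
corollary1 f₀ _ Ss ms oe sorted = length Ss , runAP-within 0 f₀ f₀ Ss ms oe dominates-refl sorted
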